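{- Let $n\ge2$ and $m\ge1$ be integers with $\gcd(n,m!)=1$. Then $\mathsf{D}_m(\mathbb{Z}_n)\le\mathsf{D}(\mathbb{Z}_n^{t(m)})+m-1$.
   Context: A sequence over $\mathbb{Z}_n$ is a finite multiset of elements; its length counts multiplicity, and a subsequence is a sub-multiset. For $S=(a_1,\dots,a_\ell)$, $e_m(S)=\sum_{1\le i_1<\dots<i_m\le\ell}\prod_{j=1}^m a_{i_j}$. $\mathsf{D}_m(\mathbb{Z}_n)$ is the smallest positive integer $t$ such that every sequence $S$ over the ring $\mathbb{Z}_n$ with $|S|\ge t$ contains a subsequence $S'$ with $|S'|\ge m$ and $e_m(S')=0$. $\mathsf{D}(G)$ is the Davenport constant of a finite abelian group $G$: the smallest positive integer $t$ such that every sequence over $G$ of length at least $t$ has a non-empty zero-sum subsequence; $\mathbb{Z}_n^{t(m)}$ is the direct sum of $t(m)$ copies of $\mathbb{Z}_n$. Here $t(m)$ is defined as follows: let $\Sigma_m$ be the set of tuples $(j_1,\dots,j_m)$ of non-negative integers with $j_1+2j_2+\cdots+mj_m=m$ (indexing the terms $\prod_i\frac{(-p_i)^{j_i}}{j_i!i^{j_i}}$ of the Girard–Newton expression of $e_m$ in power sums $p_i$); a set $T\subseteq\{1,\dots,m\}$ is dominating if every tuple in $\Sigma_m$ has $j_i\ge1$ for some $i\in T$; $t(m)$ is the minimum size of a dominating set (it equals $\lfloor m/2\rfloor+1$). -}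

module Defs where

open import Data.Nat using (ℕ; zero; suc; _+_; _*_; _≤_)
open import Data.Nat.Divisibility using (_∣_)
open import Data.Fin using (Fin; toℕ; zero; suc)
open import Data.Fin.Subset using (Subset; _∈_; ∣_∣)
open import Data.List using (List; []; _∷_; length; map)
open import Data.Nat.ListAction using (sum)
open import Data.List.Relation.Binary.Sublist.Propositional using (_⊆_)
open import Data.Vec using (Vec; lookup)
open import Data.Product using (Σ; _×_; ∃)
open import Relation.Binary.PropositionalEquality using (_≡_; _≢_)

-- Elementary symmetric polynomial e_m of a list of naturals (computed in ℕ;
-- reduction mod n is a ring homomorphism ℕ → ℤ_n, so e_m(S) = 0 in ℤ_n
-- iff n ∣ esym m (map toℕ S)).
esym : ℕ → List ℕ → ℕ
esym zero    _        = 1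
esym (suc m) []       = 0
esym (suc m) (a ∷ as) = a * esym m as + esym (suc m) as

-- Sequences over ℤ_n: lists of Fin n (a multiset; order irrelevant).
-- Sub-multisets are represented by sublists (e_m and sums are symmetric).
Seq : ℕ → Set
Seq n = List (Fin n)

EmZero : (n m : ℕ) → Seq n → Set
EmZero n m S = n ∣ esym m (map toℕ S)

DmProp : (n m : ℕ) → ℕ → Set
DmProp n m t = (S : Seq n) → t ≤ length S →
  Σ (Seq n) λ S' → (S' ⊆ S) × (m ≤ length S') × EmZero n m S'

IsLeastPos : (ℕ → Set) → ℕ → Set
IsLeastPos P t = (1 ≤ t) × P t × ((s : ℕ) → 1 ≤ s → P s → t ≤ s)

IsDm : (n m t : ℕ) → Set
IsDm n m t = IsLeastPos (DmProp n m) t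

GSeq : ℕ → ℕ → Set
GSeq n k = List (Vec (Fin n) k)

ZeroSum : (n k : ℕ) → GSeq n k → Set
ZeroSum n k T = (i : Fin k) → n ∣ sum (map (λ v → toℕ (lookup v i)) T)

DavProp : (n k : ℕ) → ℕ → Set
DavProp n k t = (S : GSeq n k) → t ≤ length S →
  Σ (GSeq n k) λ T → (T ⊆ S) × (T ≢ []) × ZeroSum n k T

IsDavenport : (n k t : ℕ) → Set
IsDavenport n k t = IsLeastPos (DavProp n k) t

-- Σ_m : tuples (j_1,…,j_m) (index i : Fin m stands for i+1) with Σ (i+1) j_i = m
weight : (m : ℕ) → (Fin m → ℕ) → ℕ
weight zero    j = 0
weight (suc m) j = j zero + weight m (λ i → j (suc i)) + weightShift m (λ i → j (suc i))
  where
  -- extra contribution from shifting indices by one: Σ_i j(i+1)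
  weightShift : (m : ℕ) → (Fin m → ℕ) → ℕ
  weightShift zero    j = 0
  weightShift (suc m) j = j zero + weightShift m (λ i → j (suc i))

InSigma : (m : ℕ) → (Fin m → ℕ) → Set
InSigma m j = weight m j ≡ m

Dominating : (m : ℕ) → Subset m → Set
Dominating m T = (j : Fin m → ℕ) → InSigma m j → ∃ λ i → (i ∈ T) × (1 ≤ j i)

IsTm : (m k : ℕ) → Set
IsTm m k = (Σ (Subset m) λ T → Dominating m T × ∣ T ∣ ≡ k)
         × ((T : Subset m) → Dominating m T → k ≤ ∣ T ∣)

-- Fix a dominating set T and send a ∈ ℤ_n to the vector (a^i mod n)_{i ∈ T} in ℤ_n^|T|.
-- Removing non-empty zero-sum subsequences from a sequence S of length ≥ D + m − 1 until
-- fewer than D terms remain, the removed terms form a subsequence S′ of length ≥ m on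
-- which every power sum p_i with i ∈ T vanishes mod n. By Newton's identities m!·e_m is
-- an integer combination of products p_{l₁}⋯p_{l_r} with l₁ + ⋯ + l_r = m; the exponent
-- tuple of such a product lies in Σ_m, so one of its factors is some p_i with i ∈ T.
-- Hence n ∣ m!·e_m(S′), and gcd(n, m!) = 1 gives e_m(S′) = 0. The least such length D_m
-- itself exists because the defining property is decidable.

module Submission where

open import Defs
open import Data.Fin using (Fin; zero; suc; toℕ)
open import Data.Fin.Subset using (Subset; _∈_; ∣_∣)
open import Data.List using (List; []; _∷_; _++_; map; length; take)
open import Data.List.Relation.Unary.All using (All; []; _∷_)
open import Data.List.Relation.Unary.Any using (here; there)
open import Data.Nat.ListAction using (sum)
open import Data.Product using (Σ; ∃; _×_; _,_)
open import Relation.Binary.PropositionalEquality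

module Weights where

  open import Data.Nat as ℕ using (ℕ; zero; suc; _+_; _≤_; _≡ᵇ_; z≤n; s≤s)
  import Data.Nat.Properties as ℕ
  open import Data.Nat.Tactic.RingSolver using (solve-∀)
  open import Data.Bool using (true; false; if_then_else_; T)
  open import Data.Vec.Functional using (tail) renaming (_∷_ to _◂_)
  open import Algebra.Properties.CommutativeMonoid.Sum ℕ.+-0-commutativeMonoid
    using (sum-syntax; ∑-distrib-+; sum-replicate-zero)
  import Data.List.Membership.Propositional as List

  -- The shift term in the definition of weight is a where-bound function; comparing with a
  -- tuple whose first entry is 0 identifies it with ∑ without naming it.
  weight-extend : ∀ m (g : Fin m → ℕ) → weight (suc m) (0 ◂ g) ≡ weight m g + ∑[ i < m ] g i
  weight-extend zero    g = refl
  weight-extend (suc m) g = cong (λ s → weight (suc m) g + (g zero + s))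
    (ℕ.+-cancelˡ-≡ (weight m (tail g)) _ _ (weight-extend m (tail g)))

  weight-suc : ∀ m (j : Fin (suc m) → ℕ) → weight (suc m) j ≡ j zero + weight m (tail j) + ∑[ i < m ] tail j i
  weight-suc m j = cong (j zero + weight m (tail j) +_)
    (ℕ.+-cancelˡ-≡ (weight m (tail j)) _ _ (weight-extend m (tail j)))

  weight-zero : ∀ m → weight m (λ _ → 0) ≡ 0
  weight-zero zero    = refl
  weight-zero (suc m) = begin
    weight (suc m) (λ _ → 0)             ≡⟨ weight-suc m (λ _ → 0) ⟩
    weight m (λ _ → 0) + ∑[ i < m ] 0    ≡⟨ cong₂ _+_ (weight-zero m) (sum-replicate-zero m) ⟩
    0                                    ∎
    where open ≡-Reasoning

  weight-+ : ∀ m (f g : Fin m → ℕ) → weight m (λ i → f i + g i) ≡ weight m f + weight m g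
  weight-+ zero    f g = refl
  weight-+ (suc m) f g = begin
    weight (suc m) (λ i → f i + g i)
      ≡⟨ weight-suc m (λ i → f i + g i) ⟩
    f zero + g zero + weight m (λ i → tail f i + tail g i) + ∑[ i < m ] (tail f i + tail g i)
      ≡⟨ cong₂ (λ u v → f zero + g zero + u + v) (weight-+ m (tail f) (tail g)) (∑-distrib-+ (tail f) (tail g)) ⟩
    f zero + g zero + (weight m (tail f) + weight m (tail g)) + (∑[ i < m ] tail f i + ∑[ i < m ] tail g i)
      ≡⟨ interchange (f zero) (g zero) (weight m (tail f)) (weight m (tail g)) _ _ ⟩
    (f zero + weight m (tail f) + ∑[ i < m ] tail f i) + (g zero + weight m (tail g) + ∑[ i < m ] tail g i)
      ≡⟨ cong₂ _+_ (weight-suc m f) (weight-suc m g) ⟨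
    weight (suc m) f + weight (suc m) g ∎
    where
    open ≡-Reasoning
    interchange : ∀ a b c d e f → a + b + (c + d) + (e + f) ≡ (a + c + e) + (b + d + f)
    interchange = solve-∀

  unit : ∀ {m} → ℕ → Fin m → ℕ
  unit l i = if suc (toℕ i) ≡ᵇ l then 1 else 0

  ∑-unit : ∀ m l → 1 ≤ l → l ≤ m → ∑[ i < m ] unit l i ≡ 1
  ∑-unit (suc m) 1             _ _         = cong suc (sum-replicate-zero m)
  ∑-unit (suc m) (suc (suc l)) _ (s≤s l<m) = ∑-unit m (suc l) (s≤s z≤n) l<m

  weight-unit : ∀ m l → 1 ≤ l → l ≤ m → weight m (unit l) ≡ l
  weight-unit (suc m) 1 _ _ = begin
    weight (suc m) (unit 1)                 ≡⟨ weight-suc m (unit 1) ⟩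
    1 + weight m (λ _ → 0) + ∑[ i < m ] 0   ≡⟨ cong₂ (λ u v → 1 + u + v) (weight-zero m) (sum-replicate-zero m) ⟩
    1                                       ∎
    where open ≡-Reasoning
  weight-unit (suc m) (suc (suc l)) _ (s≤s l<m) = begin
    weight (suc m) (unit (2 + l))
      ≡⟨ weight-suc m (unit (2 + l)) ⟩
    weight m (unit (suc l)) + ∑[ i < m ] unit (suc l) i
      ≡⟨ cong₂ _+_ (weight-unit m (suc l) (s≤s z≤n) l<m) (∑-unit m (suc l) (s≤s z≤n) l<m) ⟩
    suc l + 1
      ≡⟨ ℕ.+-comm (suc l) 1 ⟩
    2 + l ∎
    where open ≡-Reasoning

  multiplicity : ∀ {m} → List ℕ → Fin m → ℕ
  multiplicity []      i = 0
  multiplicity (l ∷ L) i = unit l i + multiplicity L i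

  weight-multiplicity : ∀ m L → All (1 ≤_) L → sum L ≤ m → weight m (multiplicity L) ≡ sum L
  weight-multiplicity m []      []          _    = weight-zero m
  weight-multiplicity m (l ∷ L) (1≤l ∷ 1≤L) ΣL≤m = begin
    weight m (multiplicity (l ∷ L))
      ≡⟨ weight-+ m (unit l) (multiplicity L) ⟩
    weight m (unit l) + weight m (multiplicity L)
      ≡⟨ cong₂ _+_ (weight-unit m l 1≤l l≤m) (weight-multiplicity m L 1≤L ∑L≤m) ⟩
    l + sum L ∎
    where
    open ≡-Reasoning
    l≤m = ℕ.≤-trans (ℕ.m≤m+n l (sum L)) ΣL≤m
    ∑L≤m = ℕ.≤-trans (ℕ.m≤n+m (sum L) l) ΣL≤m

  multiplicity-pos⇒∈ : ∀ {m} L (i : Fin m) → 1 ≤ multiplicity L i → suc (toℕ i) List.∈ L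
  multiplicity-pos⇒∈ (l ∷ L) i pos with suc (toℕ i) ≡ᵇ l in eq
  ... | true  = here (ℕ.≡ᵇ⇒≡ (suc (toℕ i)) l (subst T (sym eq) _))
  ... | false = there (multiplicity-pos⇒∈ L i pos)

module PowerSums where

  open Weights
  open import Data.Nat as ℕ using (ℕ; zero; suc; _≤_; _!; z≤n; s≤s)
  import Data.Nat.Properties as ℕ
  open import Data.Nat.Divisibility as ℕ using ()
  open import Data.Nat.Coprimality using (gcd≡1⇒coprime; coprime-divisor)
  open import Data.Nat.GCD using (gcd)
  open import Data.Integer as ℤ using (ℤ; +_; 0ℤ; 1ℤ; _+_; _*_; _-_; -_; _^_)
  import Data.Integer.Properties as ℤ
  open import Data.Integer.Divisibility.Signed using (_∣_; ∣m∣n⇒∣m+n; ∣n⇒∣m*n; ∣m⇒∣m*n; ∣ᵤ⇒∣; ∣⇒∣ᵤ)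
  open import Data.Integer.Tactic.RingSolver using (solve-∀)
  open import Data.Sum using (inj₁; inj₂)
  import Data.List.Membership.Propositional as List

  elementary : ℕ → List ℤ → ℤ
  elementary zero    _        = 1ℤ
  elementary (suc k) []       = 0ℤ
  elementary (suc k) (x ∷ xs) = x * elementary k xs + elementary (suc k) xs

  powerSum : ℕ → List ℤ → ℤ
  powerSum i []       = 0ℤ
  powerSum i (x ∷ xs) = x ^ i + powerSum i xs

  -- newtonSum a b = Σ_{i=0}^{a} (-1)^i e_{a-i} p_{b+i}
  newtonSum : ℕ → ℕ → List ℤ → ℤ
  newtonSum zero    b xs = powerSum b xs
  newtonSum (suc a) b xs = elementary (suc a) xs * powerSum b xs - newtonSum a (suc b) xs

  newtonSum-[] : ∀ a b → newtonSum a b [] ≡ 0ℤ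
  newtonSum-[] zero    b = refl
  newtonSum-[] (suc a) b rewrite newtonSum-[] a (suc b) = refl

  newtonSum-∷ : ∀ a b x xs → newtonSum (suc a) b (x ∷ xs) ≡
    newtonSum (suc a) b xs + x * newtonSum a b xs + x ^ b * elementary (suc a) xs
  newtonSum-∷ zero b x xs =
    identity x (elementary 1 xs) (x ^ b) (powerSum b xs) (powerSum (suc b) xs)
    where
    identity : ∀ x e xb p p′ → (x * 1ℤ + e) * (xb + p) - (x * xb + p′) ≡ (e * p - p′) + x * p + xb * e
    identity = solve-∀
  newtonSum-∷ (suc a) b x xs = begin
    (x * e + e′) * (x ^ b + p) - newtonSum (suc a) (suc b) (x ∷ xs)
      ≡⟨ cong (λ t → (x * e + e′) * (x ^ b + p) - t) (newtonSum-∷ a (suc b) x xs) ⟩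
    (x * e + e′) * (x ^ b + p) - (N + x * N′ + x * x ^ b * e)
      ≡⟨ identity x e e′ (x ^ b) p N N′ ⟩
    (e′ * p - N) + x * (e * p - N′) + x ^ b * e′ ∎
    where
    open ≡-Reasoning
    e = elementary (suc a) xs
    e′ = elementary (suc (suc a)) xs
    p = powerSum b xs
    N = newtonSum (suc a) (suc b) xs
    N′ = newtonSum a (suc b) xs
    identity : ∀ x e e′ xb p N N′ → (x * e + e′) * (xb + p) - (N + x * N′ + x * xb * e)
                                   ≡ (e′ * p - N) + x * (e * p - N′) + xb * e′
    identity = solve-∀

  newton-identity : ∀ k xs → newtonSum k 1 xs ≡ + suc k * elementary (suc k) xs
  newton-identity k [] = trans (newtonSum-[] k 1) (sym (ℤ.*-zeroʳ (+ suc k)))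
  newton-identity zero (x ∷ xs) = begin
    x * 1ℤ + powerSum 1 xs                ≡⟨ cong (_+_ (x * 1ℤ)) (newton-identity zero xs) ⟩
    x * 1ℤ + 1ℤ * elementary 1 xs          ≡⟨ identity x (elementary 1 xs) ⟩
    1ℤ * (x * 1ℤ + elementary 1 xs) ∎
    where
    open ≡-Reasoning
    identity : ∀ x e → x * 1ℤ + 1ℤ * e ≡ 1ℤ * (x * 1ℤ + e)
    identity = solve-∀
  newton-identity (suc a) (x ∷ xs) = begin
    newtonSum (suc a) 1 (x ∷ xs)
      ≡⟨ newtonSum-∷ a 1 x xs ⟩
    newtonSum (suc a) 1 xs + x * newtonSum a 1 xs + x * 1ℤ * e
      ≡⟨ cong₂ (λ u v → u + x * v + x * 1ℤ * e) (newton-identity (suc a) xs) (newton-identity a xs) ⟩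
    (1ℤ + + suc a) * e′ + x * (+ suc a * e) + x * 1ℤ * e
      ≡⟨ identity x (+ suc a) e e′ ⟩
    (1ℤ + + suc a) * (x * e + e′) ∎
    where
    open ≡-Reasoning
    e = elementary (suc a) xs
    e′ = elementary (suc (suc a)) xs
    identity : ∀ x c e e′ → (1ℤ + c) * e′ + x * (c * e) + x * 1ℤ * e ≡ (1ℤ + c) * (x * e + e′)
    identity = solve-∀

  powerProduct : List ℕ → List ℤ → ℤ
  powerProduct []      xs = 1ℤ
  powerProduct (l ∷ L) xs = powerSum l xs * powerProduct L xs

  data Isobaric (xs : List ℤ) (w : ℕ) : ℤ → Set where
    monomial : ∀ {L} → All (1 ≤_) L → sum L ≡ w → Isobaric xs w (powerProduct L xs)
    _⊕_      : ∀ {x y} → Isobaric xs w x → Isobaric xs w y → Isobaric xs w (x + y)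
    scale    : ∀ c {x} → Isobaric xs w x → Isobaric xs w (c * x)

  reweigh : ∀ {xs w w′ x} → w ≡ w′ → Isobaric xs w x → Isobaric xs w′ x
  reweigh {xs} {x = x} = subst (λ w → Isobaric xs w x)

  powerSum-*-Isobaric : ∀ {xs i w x} → 1 ≤ i → Isobaric xs w x → Isobaric xs (i ℕ.+ w) (powerSum i xs * x)
  powerSum-*-Isobaric {i = i} 1≤i (monomial 1≤L ΣL≡w) = monomial (1≤i ∷ 1≤L) (cong (i ℕ.+_) ΣL≡w)
  powerSum-*-Isobaric {xs} {i} 1≤i (_⊕_ {x} {y} u v) =
    subst (Isobaric xs _) (sym (ℤ.*-distribˡ-+ (powerSum i xs) x y))
      (powerSum-*-Isobaric 1≤i u ⊕ powerSum-*-Isobaric 1≤i v)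
  powerSum-*-Isobaric {xs} {i} 1≤i (scale c {x} u) =
    subst (Isobaric xs _) (identity c (powerSum i xs) x) (scale c (powerSum-*-Isobaric 1≤i u))
    where
    identity : ∀ c p x → c * (p * x) ≡ p * (c * x)
    identity = solve-∀

  newtonSum-Isobaric : ∀ xs a b → 1 ≤ b → (∀ j → j ≤ a → Isobaric xs j (+ (j !) * elementary j xs)) →
    Isobaric xs (a ℕ.+ b) (+ (a !) * newtonSum a b xs)
  newtonSum-Isobaric xs zero b 1≤b _ =
    subst (Isobaric xs b) (trans (ℤ.*-identityʳ _) (sym (ℤ.*-identityˡ _))) (monomial (1≤b ∷ []) (ℕ.+-identityʳ b))
  newtonSum-Isobaric xs (suc a) b 1≤b hyp =
    subst (Isobaric xs _) value (leading ⊕ scale (- + suc a) tail)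
    where
    leading : Isobaric xs (suc a ℕ.+ b) (powerSum b xs * (+ (suc a !) * elementary (suc a) xs))
    leading = reweigh (ℕ.+-comm b (suc a)) (powerSum-*-Isobaric 1≤b (hyp (suc a) ℕ.≤-refl))
    tail : Isobaric xs (suc a ℕ.+ b) (+ (a !) * newtonSum a (suc b) xs)
    tail = reweigh (ℕ.+-suc a b)
      (newtonSum-Isobaric xs a (suc b) (s≤s z≤n) (λ j j≤a → hyp j (ℕ.m≤n⇒m≤1+n j≤a)))
    open ≡-Reasoning
    p = powerSum b xs
    e = elementary (suc a) xs
    N = newtonSum a (suc b) xs
    identity : ∀ p c f e N → p * ((c * f) * e) + - c * (f * N) ≡ (c * f) * (e * p - N)
    identity = solve-∀
    value : p * (+ (suc a !) * e) + - + suc a * (+ (a !) * N) ≡ + (suc a !) * newtonSum (suc a) b xs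
    value = begin
      p * (+ (suc a !) * e) + - + suc a * (+ (a !) * N)
        ≡⟨ cong (λ F → p * (F * e) + - + suc a * (+ (a !) * N)) (ℤ.pos-* (suc a) (a !)) ⟩
      p * ((+ suc a * + (a !)) * e) + - + suc a * (+ (a !) * N)
        ≡⟨ identity p (+ suc a) (+ (a !)) e N ⟩
      (+ suc a * + (a !)) * (e * p - N)
        ≡⟨ cong (_* (e * p - N)) (ℤ.pos-* (suc a) (a !)) ⟨
      + (suc a !) * newtonSum (suc a) b xs ∎

  factorial*elementary-Isobaric : ∀ xs m → Isobaric xs m (+ (m !) * elementary m xs)
  factorial*elementary-Isobaric xs m = below m m ℕ.≤-refl
    where
    below : ∀ k j → j ≤ k → Isobaric xs j (+ (j !) * elementary j xs)
    below zero    .zero z≤n = monomial [] refl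
    below (suc k) j j≤1+k with ℕ.m≤n⇒m<n∨m≡n j≤1+k
    ... | inj₁ (s≤s j≤k) = below k j j≤k
    ... | inj₂ refl      = reweigh (ℕ.+-comm k 1) (subst (Isobaric xs (k ℕ.+ 1)) value
                               (newtonSum-Isobaric xs k 1 (s≤s z≤n) (below k)))
      where
      value : + (k !) * newtonSum k 1 xs ≡ + (suc k !) * elementary (suc k) xs
      value = begin
        + (k !) * newtonSum k 1 xs                    ≡⟨ cong (+ (k !) *_) (newton-identity k xs) ⟩
        + (k !) * (+ suc k * elementary (suc k) xs)   ≡⟨ identity (+ (k !)) (+ suc k) _ ⟩
        (+ suc k * + (k !)) * elementary (suc k) xs   ≡⟨ cong (_* elementary (suc k) xs) (ℤ.pos-* (suc k) (k !)) ⟨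
        + (suc k !) * elementary (suc k) xs ∎
        where
        open ≡-Reasoning
        identity : ∀ f c e → f * (c * e) ≡ (c * f) * e
        identity = solve-∀

  ∈⇒∣powerProduct : ∀ {d l L} xs → l List.∈ L → d ∣ powerSum l xs → d ∣ powerProduct L xs
  ∈⇒∣powerProduct {L = _ ∷ L} xs (here refl) d∣p = ∣m⇒∣m*n (powerProduct L xs) d∣p
  ∈⇒∣powerProduct {L = l ∷ _} xs (there l∈L) d∣p = ∣n⇒∣m*n (powerSum l xs) (∈⇒∣powerProduct xs l∈L d∣p)

  Isobaric-divisible : ∀ {m} (T : Subset m) → Dominating m T → ∀ {d xs} →
    (∀ i → i ∈ T → d ∣ powerSum (suc (toℕ i)) xs) → ∀ {x} → Isobaric xs m x → d ∣ x
  -- The exponent tuple of the monomial p_L lies in Σ_m, so T meets it.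
  Isobaric-divisible {m} T dominating {xs = xs} d∣p (monomial {L} 1≤L ΣL≡m)
    with dominating (multiplicity L) (trans (weight-multiplicity m L 1≤L (ℕ.≤-reflexive ΣL≡m)) ΣL≡m)
  ... | i , i∈T , 1≤mult = ∈⇒∣powerProduct xs (multiplicity-pos⇒∈ L i 1≤mult) (d∣p i i∈T)
  Isobaric-divisible T dominating d∣p (u ⊕ v) =
    ∣m∣n⇒∣m+n (Isobaric-divisible T dominating d∣p u) (Isobaric-divisible T dominating d∣p v)
  Isobaric-divisible T dominating d∣p (scale c u) = ∣n⇒∣m*n c (Isobaric-divisible T dominating d∣p u)

  pos-^ : ∀ a i → + (a ℕ.^ i) ≡ (+ a) ^ i
  pos-^ a zero    = refl
  pos-^ a (suc i) = trans (ℤ.pos-* a (a ℕ.^ i)) (cong (+ a *_) (pos-^ a i))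

  powerSum-pos : ∀ i xs → powerSum i (map +_ xs) ≡ + sum (map (ℕ._^ i) xs)
  powerSum-pos i []       = refl
  powerSum-pos i (a ∷ xs) = begin
    (+ a) ^ i + powerSum i (map +_ xs)       ≡⟨ cong₂ _+_ (sym (pos-^ a i)) (powerSum-pos i xs) ⟩
    + (a ℕ.^ i) + + sum (map (ℕ._^ i) xs)    ≡⟨ ℤ.pos-+ (a ℕ.^ i) _ ⟨
    + sum (map (ℕ._^ i) (a ∷ xs))            ∎
    where open ≡-Reasoning

  elementary-pos : ∀ k xs → elementary k (map +_ xs) ≡ + esym k xs
  elementary-pos zero    xs       = refl
  elementary-pos (suc k) []       = refl
  elementary-pos (suc k) (a ∷ xs) = begin
    + a * elementary k (map +_ xs) + elementary (suc k) (map +_ xs)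
      ≡⟨ cong₂ (λ u v → + a * u + v) (elementary-pos k xs) (elementary-pos (suc k) xs) ⟩
    + a * + esym k xs + + esym (suc k) xs
      ≡⟨ cong (_+ + esym (suc k) xs) (ℤ.pos-* a (esym k xs)) ⟨
    + (a ℕ.* esym k xs) + + esym (suc k) xs
      ≡⟨ ℤ.pos-+ (a ℕ.* esym k xs) _ ⟨
    + esym (suc k) (a ∷ xs) ∎
    where open ≡-Reasoning

  dominating-powerSums⇒∣esym : ∀ n m → gcd n (m !) ≡ 1 → (T : Subset m) → Dominating m T → ∀ xs →
    (∀ i → i ∈ T → n ℕ.∣ sum (map (ℕ._^ suc (toℕ i)) xs)) → n ℕ.∣ esym m xs
  dominating-powerSums⇒∣esym n m coprime T dominating xs n∣p =
    coprime-divisor (gcd≡1⇒coprime coprime) (∣⇒∣ᵤ (subst (+ n ∣_) value n∣m!e))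
    where
    n∣m!e : + n ∣ + (m !) * elementary m (map +_ xs)
    n∣m!e = Isobaric-divisible T dominating
      (λ i i∈T → subst (+ n ∣_) (sym (powerSum-pos (suc (toℕ i)) xs)) (∣ᵤ⇒∣ (n∣p i i∈T)))
      (factorial*elementary-Isobaric (map +_ xs) m)
    value : + (m !) * elementary m (map +_ xs) ≡ + (m ! ℕ.* esym m xs)
    value = trans (cong (+ (m !) *_) (elementary-pos m xs)) (sym (ℤ.pos-* (m !) (esym m xs)))

open PowerSums using (dominating-powerSums⇒∣esym)
open import Data.Nat using (ℕ; zero; suc; _+_; _∸_; _≤_; _<_; _<?_; _≤?_; _%_; _^_; _!; NonZero; >-nonZero; z≤n; s≤s)
import Data.Nat.Properties as ℕ
open import Data.Nat.Induction using (<-wellFounded)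
open import Data.Nat.DivMod using (_mod_; %-distribˡ-+; m%n%n≡m%n)
open import Data.Nat.Divisibility using (_∣_; _∣0; _∣?_; ∣m∣n⇒∣m+n; m%n≡0⇒n∣m; n∣m⇒m%n≡0)
open import Data.Nat.GCD using (gcd)
open import Data.Nat.ListAction.Properties using (sum-++; sum-↭)
open import Algebra.Properties.CommutativeSemigroup ℕ.+-commutativeSemigroup using (x∙yz≈y∙xz)
open import Induction.WellFounded using (Acc; acc)
open import Data.Bool using (true; false)
import Data.Fin.Properties as Fin
open import Data.Vec using (Vec; lookup; tabulate; here; there) renaming (_∷_ to _◂_)
import Data.Vec.Properties as Vec
import Data.List.Properties as List
open import Data.List.Relation.Binary.Sublist.Propositional using (_⊆_; []; _∷_; _∷ʳ_; minimum; ⊆-trans)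
open import Data.List.Relation.Binary.Sublist.Propositional.Properties using (take-⊆)
open import Data.List.Relation.Ternary.Interleaving.Propositional using (Interleaving; []; consˡ; consʳ; toPermutation)
open import Data.List.Relation.Ternary.Interleaving.Properties using (interleave-length)
import Data.List.Relation.Binary.Permutation.Propositional.Properties as Perm
open import Data.Empty using (⊥-elim)
open import Relation.Nullary using (Dec; yes; no; _×-dec_)
open import Relation.Nullary.Decidable using (map′)

module _ {A : Set} where

  ⊆-complement : ∀ {X R : List A} → X ⊆ R → ∃ λ Y → Interleaving X Y R
  ⊆-complement []         = [] , []
  ⊆-complement (x ∷ʳ X⊆R) with ⊆-complement X⊆R
  ... | Y , X⋈Y = x ∷ Y , consʳ X⋈Y
  ⊆-complement (refl ∷ X⊆R) with ⊆-complement X⊆R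
  ... | Y , X⋈Y = Y , consˡ X⋈Y

  Interleaving-⊆ʳ : ∀ {X Y R Z : List A} → Interleaving X Y R → Z ⊆ Y → ∃ λ W → W ⊆ R × Interleaving X Z W
  Interleaving-⊆ʳ []            []           = [] , [] , []
  Interleaving-⊆ʳ (consˡ X⋈Y)  Z⊆Y          with Interleaving-⊆ʳ X⋈Y Z⊆Y
  ... | W , W⊆R , X⋈Z = _ ∷ W , refl ∷ W⊆R , consˡ X⋈Z
  Interleaving-⊆ʳ (consʳ X⋈Y) (y ∷ʳ Z⊆Y)   with Interleaving-⊆ʳ X⋈Y Z⊆Y
  ... | W , W⊆R , X⋈Z = W , y ∷ʳ W⊆R , X⋈Z
  Interleaving-⊆ʳ (consʳ X⋈Y) (refl ∷ Z⊆Y) with Interleaving-⊆ʳ X⋈Y Z⊆Y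
  ... | W , W⊆R , X⋈Z = _ ∷ W , refl ∷ W⊆R , consʳ X⋈Z

  Interleaving-length-<ʳ : ∀ {X Y R : List A} → Interleaving X Y R → X ≢ [] → length Y < length R
  Interleaving-length-<ʳ {[]}    _   X≢[] = ⊥-elim (X≢[] refl)
  Interleaving-length-<ʳ {x ∷ X} {Y} X⋈Y _ =
    subst (length Y <_) (sym (interleave-length X⋈Y)) (ℕ.m<n+m (length Y) (s≤s (z≤n {length X})))

  Interleaving-shortfall : ∀ {X Y R Z W : List A} {d} → Interleaving X Y R → Interleaving X Z W →
    length Y < d + length Z → length R < d + length W
  Interleaving-shortfall {X} {Y} {R} {Z} {W} {d} X⋈Y X⋈Z |Y|<d+|Z| = begin-strict
    length R                      ≡⟨ interleave-length X⋈Y ⟩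
    length X + length Y           <⟨ ℕ.+-monoʳ-< (length X) |Y|<d+|Z| ⟩
    length X + (d + length Z)     ≡⟨ x∙yz≈y∙xz (length X) d (length Z) ⟩
    d + (length X + length Z)     ≡⟨ cong (d +_) (interleave-length X⋈Z) ⟨
    d + length W                  ∎
    where open ℕ.≤-Reasoning

  module _ (P : List A → Set) (P-[] : P [])
           (P-interleave : ∀ {X Y Z} → Interleaving X Y Z → P X → P Y → P Z)
           {d : ℕ} (extract : ∀ R → d ≤ length R → ∃ λ X → X ⊆ R × X ≢ [] × P X) where

    exhaust : ∀ R → ∃ λ Z → Z ⊆ R × P Z × length R < d + length Z
    exhaust R = go R (<-wellFounded (length R))
      where
      go : ∀ R → Acc _<_ (length R) → ∃ λ Z → Z ⊆ R × P Z × length R < d + length Z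
      go R _ with length R <? d
      go R _ | yes |R|<d = [] , minimum R , P-[] , subst (length R <_) (sym (ℕ.+-identityʳ d)) |R|<d
      go R (acc smaller) | no |R|≮d with extract R (ℕ.≮⇒≥ |R|≮d)
      ... | X , X⊆R , X≢[] , PX with ⊆-complement X⊆R
      ... | Y , X⋈Y with go Y (smaller (Interleaving-length-<ʳ X⋈Y X≢[]))
      ... | Z , Z⊆Y , PZ , |Y|<d+|Z| with Interleaving-⊆ʳ X⋈Y Z⊆Y
      ... | W , W⊆R , X⋈Z =
        W , W⊆R , P-interleave X⋈Z PX PZ , Interleaving-shortfall X⋈Y X⋈Z |Y|<d+|Z|

map-⊆⁻ : ∀ {A B : Set} (f : A → B) {T} R → T ⊆ map f R → ∃ λ X → X ⊆ R × map f X ≡ T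
map-⊆⁻ f []      []         = [] , [] , refl
map-⊆⁻ f (x ∷ R) (_ ∷ʳ T⊆R) with map-⊆⁻ f R T⊆R
... | X , X⊆R , refl = X , x ∷ʳ X⊆R , refl
map-⊆⁻ f (x ∷ R) (refl ∷ T⊆R) with map-⊆⁻ f R T⊆R
... | X , X⊆R , refl = x ∷ X , refl ∷ X⊆R , refl

sum-map-interleave : ∀ {A : Set} (g : A → ℕ) {X Y Z} → Interleaving X Y Z →
  sum (map g Z) ≡ sum (map g X) + sum (map g Y)
sum-map-interleave g {X} {Y} {Z} X⋈Y = begin
  sum (map g Z)                  ≡⟨ sum-↭ (Perm.map⁺ g (toPermutation X⋈Y)) ⟩
  sum (map g (X ++ Y))           ≡⟨ cong sum (List.map-++ g X Y) ⟩
  sum (map g X ++ map g Y)       ≡⟨ sum-++ (map g X) (map g Y) ⟩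
  sum (map g X) + sum (map g Y)  ∎
  where open ≡-Reasoning

sum-% : ∀ n .{{_ : NonZero n}} {A : Set} (f : A → ℕ) xs →
  sum (map f xs) % n ≡ sum (map (λ a → f a % n) xs) % n
sum-% n f []       = refl
sum-% n f (x ∷ xs) = begin
  (f x + sum (map f xs)) % n
    ≡⟨ %-distribˡ-+ (f x) _ n ⟩
  (f x % n + sum (map f xs) % n) % n
    ≡⟨ cong₂ (λ u v → (u + v) % n) (sym (m%n%n≡m%n (f x) n)) (sum-% n f xs) ⟩
  (f x % n % n + sum (map (λ a → f a % n) xs) % n) % n
    ≡⟨ %-distribˡ-+ (f x % n) _ n ⟨
  (f x % n + sum (map (λ a → f a % n) xs)) % n ∎
  where open ≡-Reasoning

ZeroSum-[] : ∀ n k → ZeroSum n k []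
ZeroSum-[] n k _ = n ∣0

ZeroSum-interleave : ∀ {n k X Y Z} → Interleaving X Y Z → ZeroSum n k X → ZeroSum n k Y → ZeroSum n k Z
ZeroSum-interleave {n} X⋈Y zsX zsY i =
  subst (n ∣_) (sym (sum-map-interleave (λ v → toℕ (lookup v i)) X⋈Y)) (∣m∣n⇒∣m+n (zsX i) (zsY i))

member : ∀ {m} (T : Subset m) → Fin ∣ T ∣ → Fin m
member (true  ◂ T) zero    = zero
member (true  ◂ T) (suc c) = suc (member T c)
member (false ◂ T) c       = suc (member T c)

member-surjective : ∀ {m} (T : Subset m) {i} → i ∈ T → ∃ λ c → member T c ≡ i
member-surjective (true  ◂ T) here       = zero , refl
member-surjective (true  ◂ T) (there i∈T) with member-surjective T i∈T
... | c , refl = suc c , refl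
member-surjective (false ◂ T) (there i∈T) with member-surjective T i∈T
... | c , refl = c , refl

module _ (n : ℕ) .{{_ : NonZero n}} {m} (T : Subset m) where

  powerVector : Fin n → Vec (Fin n) ∣ T ∣
  powerVector a = tabulate λ c → (toℕ a ^ suc (toℕ (member T c))) mod n

  ZeroSum-powerVectors⇒∣powerSum : ∀ S → ZeroSum n ∣ T ∣ (map powerVector S) →
    ∀ i → i ∈ T → n ∣ sum (map (_^ suc (toℕ i)) (map toℕ S))
  ZeroSum-powerVectors⇒∣powerSum S zeroSum i i∈T with member-surjective T i∈T
  ... | c , refl = m%n≡0⇒n∣m _ n (begin
    sum (map (_^ e) (map toℕ S)) % n                ≡⟨ sum-% n (_^ e) (map toℕ S) ⟩
    sum (map (λ x → x ^ e % n) (map toℕ S)) % n     ≡⟨ n∣m⇒m%n≡0 _ n (subst (n ∣_) coordinates (zeroSum c)) ⟩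
    0                                               ∎)
    where
    open ≡-Reasoning
    e = suc (toℕ (member T c))
    coordinate : ∀ a → toℕ (lookup (powerVector a) c) ≡ toℕ a ^ e % n
    coordinate a = trans (cong toℕ (Vec.lookup∘tabulate _ c)) (Fin.toℕ-fromℕ< _)
    coordinates : sum (map (λ v → toℕ (lookup v c)) (map powerVector S)) ≡ sum (map (λ x → x ^ e % n) (map toℕ S))
    coordinates = cong sum (trans (sym (List.map-∘ S)) (trans (List.map-cong coordinate S) (List.map-∘ S)))

shortfall⇒length : ∀ d m s z → 1 ≤ m → d + m ∸ 1 ≤ s → s < d + z → m ≤ z
shortfall⇒length d (suc m) s z _ d+m≤s s<d+z = ℕ.+-cancelˡ-< d m z (begin-strict
  d + m              ≡⟨ cong (_∸ 1) (ℕ.+-suc d m) ⟨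
  d + suc m ∸ 1      ≤⟨ d+m≤s ⟩
  s                  <⟨ s<d+z ⟩
  d + z              ∎)
  where open ℕ.≤-Reasoning

DavProp⇒DmProp : ∀ n .{{_ : NonZero n}} m → 1 ≤ m → gcd n (m !) ≡ 1 → (T : Subset m) → Dominating m T →
  ∀ d → DavProp n ∣ T ∣ d → DmProp n m (d + m ∸ 1)
DavProp⇒DmProp n m 1≤m coprime T dominating d davenport S d+m-1≤|S|
  with exhaust (ZeroSum n ∣ T ∣) (ZeroSum-[] n ∣ T ∣) ZeroSum-interleave davenport (map (powerVector n T) S)
... | Z , Z⊆ , zeroSum , shortfall with map-⊆⁻ (powerVector n T) S Z⊆
... | S′ , S′⊆S , refl = S′ , S′⊆S , m≤|S′| ,
  dominating-powerSums⇒∣esym n m coprime T dominating (map toℕ S′) (ZeroSum-powerVectors⇒∣powerSum n T S′ zeroSum)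
  where
  m≤|S′| : m ≤ length S′
  m≤|S′| = shortfall⇒length d m (length S) (length S′) 1≤m d+m-1≤|S|
    (subst₂ (λ s z → s < d + z) (List.length-map _ S) (List.length-map _ S′) shortfall)

any-⊆? : ∀ {A : Set} {Q : List A → Set} → (∀ X → Dec (Q X)) → ∀ R → Dec (∃ λ X → X ⊆ R × Q X)
any-⊆? Q? [] with Q? []
... | yes q = yes ([] , [] , q)
... | no ¬q = no λ { ([] , [] , q) → ¬q q }
any-⊆? Q? (x ∷ R) with any-⊆? (λ X → Q? (x ∷ X)) R | any-⊆? Q? R
... | yes (X , X⊆R , q) | _                   = yes (x ∷ X , refl ∷ X⊆R , q)
... | no _              | yes (X , X⊆R , q)   = yes (X , x ∷ʳ X⊆R , q)
... | no ¬with          | no ¬without         = no λ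
  { (X , _ ∷ʳ X⊆R , q)          → ¬without (X , X⊆R , q)
  ; (_ ∷ X , refl ∷ X⊆R , q)    → ¬with (X , X⊆R , q)
  }

all-of-length? : ∀ {n} {Q : List (Fin n) → Set} → (∀ S → Dec (Q S)) →
  ∀ s → Dec (∀ S → length S ≡ s → Q S)
all-of-length? Q? zero = map′ (λ q → λ { [] refl → q }) (λ h → h [] refl) (Q? [])
all-of-length? Q? (suc s) =
  map′ (λ h → λ { (x ∷ S) |S|≡s → h x S (ℕ.suc-injective |S|≡s) })
       (λ h x S |S|≡s → h (x ∷ S) (cong suc |S|≡s))
    (Fin.all? (λ x → all-of-length? (λ S → Q? (x ∷ S)) s))

-- Only the finitely many sequences of length exactly s need to be inspected.
DmProp? : ∀ n m s → Dec (DmProp n m s)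
DmProp? n m s = map′ from-exact to-exact
  (all-of-length? (any-⊆? (λ S′ → (m ≤? length S′) ×-dec (n ∣? esym m (map toℕ S′)))) s)
  where
  Good : Seq n → Set
  Good S = ∃ λ S′ → S′ ⊆ S × m ≤ length S′ × EmZero n m S′
  from-exact : (∀ S → length S ≡ s → Good S) → DmProp n m s
  from-exact h S s≤|S| with h (take s S) (trans (List.length-take s S) (ℕ.m≤n⇒m⊓n≡m s≤|S|))
  ... | S′ , S′⊆ , good = S′ , ⊆-trans S′⊆ (take-⊆ s S) , good
  to-exact : DmProp n m s → ∀ S → length S ≡ s → Good S
  to-exact h S |S|≡s = h S (ℕ.≤-reflexive (sym |S|≡s))

least-positive : ∀ {P : ℕ → Set} → (∀ s → Dec (P s)) →
  ∀ {t} → 1 ≤ t → P t → ∃ λ u → IsLeastPos P u × u ≤ t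
least-positive {P} P? {t} = go t (<-wellFounded t)
  where
  go : ∀ t → Acc _<_ t → 1 ≤ t → P t → ∃ λ u → IsLeastPos P u × u ≤ t
  go t (acc smaller) 1≤t Pt with ℕ.anyUpTo? (λ s → (1 ≤? s) ×-dec P? s) t
  ... | no ¬below = t , (1≤t , Pt , λ s 1≤s Ps → ℕ.≮⇒≥ λ s<t → ¬below (s , s<t , 1≤s , Ps)) , ℕ.≤-refl
  ... | yes (s , s<t , 1≤s , Ps) with go s (smaller s<t) 1≤s Ps
  ... | u , least , u≤s = u , least , ℕ.≤-trans u≤s (ℕ.<⇒≤ s<t)

theorem20 : (n m : ℕ) → 2 ≤ n → 1 ≤ m → gcd n (m !) ≡ 1 →
    (k : ℕ) → IsTm m k → (d : ℕ) → IsDavenport n k d →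
      Σ ℕ λ dm → IsDm n m dm × dm ≤ d + m ∸ 1
theorem20 n m 2≤n 1≤m coprime .(∣ T ∣) ((T , dominating , refl) , _) d (1≤d , davenport , _) =
  least-positive (DmProp? n m) 1≤d+m-1
    (DavProp⇒DmProp n {{>-nonZero (ℕ.<⇒≤ 2≤n)}} m 1≤m coprime T dominating d davenport)
  where
  1≤d+m-1 : 1 ≤ d + m ∸ 1
  1≤d+m-1 = ℕ.≤-trans 1≤d (ℕ.≤-trans (ℕ.m≤m+n d (m ∸ 1)) (ℕ.≤-reflexive (sym (ℕ.+-∸-assoc d 1≤m))))
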